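{- If a finite poset $P$ is LE-cactus, then $A_1\oplus P$ is LE-cactus.
   Context: For an $n$-element poset $P$, a linear extension is a list $(p_1,\dots,p_n)$ of all elements with $p_a<_P p_b$ implying $a<b$; ${\mathcal{L}}(P)$ is the set of these. The Bender--Knuth move $t_i$ ($1\le i\le n-1$) acts on ${\mathcal{L}}(P)$ by swapping $p_i,p_{i+1}$ if incomparable and fixing the list otherwise; $\mathcal{BK}_P$ is the permutation group they generate. Let $q_m=t_1(t_2t_1)\cdots(t_mt_{m-1}\cdots t_1)$ and $q_{jk}=q_{k-1}q_{k-j}q_{k-1}$. An $n$-element poset is LE-cactus if $(t_iq_{jk})^2=1$ holds in $\mathcal{BK}_P$ for all $2\le i+1<j<k\le n$. $A_1$ is a one-element poset and $A_1\oplus P$ is the ordinal sum, i.e. $P$ with a new element added below every element of $P$. -}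

module Defs where

open import Level using (0ℓ)
open import Data.Nat using (ℕ; zero; suc; _+_; _∸_; _<_; _≤_; s≤s; z≤n)
open import Data.Fin using (Fin) renaming (zero to fzero; suc to fsuc; _<_ to _<ᶠ_)
open import Data.Vec using (Vec; []; _∷_; lookup)
open import Data.Vec.Membership.Propositional using (_∈_)
open import Data.Product using (_×_; _,_)
open import Data.Sum using (inj₁; inj₂)
open import Data.Empty using (⊥)
open import Data.Unit using (⊤; tt)
open import Function using (id; _∘_)
open import Relation.Nullary using (¬_; Dec; yes; no)
open import Relation.Binary using (Rel; IsDecPartialOrder; IsPartialOrder; IsPreorder)
open import Relation.Binary.PropositionalEquality using (_≡_; _≢_; refl; cong; isEquivalence)

record FinPoset (n : ℕ) : Set₁ where
  field
    _≼_ : Rel (Fin n) 0ℓ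
    isDecPartialOrder : IsDecPartialOrder _≡_ _≼_
  open IsDecPartialOrder isDecPartialOrder using (_≤?_)

  _≺_ : Rel (Fin n) 0ℓ
  a ≺ b = (a ≼ b) × (a ≢ b)

  Incomparable : Fin n → Fin n → Set
  Incomparable a b = ¬ (a ≼ b) × ¬ (b ≼ a)

  incomparable? : (a b : Fin n) → Dec (Incomparable a b)
  incomparable? a b with a ≤? b | b ≤? a
  ... | yes p | _     = no (λ { (x , _) → x p })
  ... | no _  | yes q = no (λ { (_ , y) → y q })
  ... | no p  | no q  = yes (p , q)

open FinPoset public using (_≼_; isDecPartialOrder; _≺_; Incomparable; incomparable?)

-- Linear extensions: lists (p_1,…,p_n) of all elements (written as
-- vectors of length n, positions 0-based) with p_a <_P p_b ⇒ a < b.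

IsLinearExtension : ∀ {n} → FinPoset n → Vec (Fin n) n → Set
IsLinearExtension {n} P L =
  (∀ x → x ∈ L) ×
  (∀ a b → lookup L a ≡ lookup L b → a ≡ b) ×
  (∀ a b → _≺_ P (lookup L a) (lookup L b) → a <ᶠ b)

-- Bender–Knuth moves t_i (1-based i): swap the entries in positions
-- i and i+1 if they are incomparable, else do nothing.  Defined on all
-- vectors; out-of-range indices act as the identity.

module _ {n : ℕ} (P : FinPoset n) where

  t : ℕ → ∀ {m} → Vec (Fin n) m → Vec (Fin n) m
  t zero          xs                 = xs
  t (suc zero)    []                 = []
  t (suc zero)    (a ∷ [])           = a ∷ []
  t (suc zero)    (a ∷ b ∷ rest) with incomparable? P a b
  ... | yes _ = b ∷ a ∷ rest
  ... | no  _ = a ∷ b ∷ rest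
  t (suc (suc i)) []                 = []
  t (suc (suc i)) (a ∷ rest)         = a ∷ t (suc i) rest

  -- r_m = t_m t_{m-1} ⋯ t_1   (products are compositions: rightmost acts first)
  r : ℕ → Vec (Fin n) n → Vec (Fin n) n
  r zero    = id
  r (suc m) = t (suc m) ∘ r m

  -- q_m = t_1 (t_2 t_1) ⋯ (t_m t_{m-1} ⋯ t_1)
  q : ℕ → Vec (Fin n) n → Vec (Fin n) n
  q zero    = id
  q (suc m) = q m ∘ r (suc m)

  qq : ℕ → ℕ → Vec (Fin n) n → Vec (Fin n) n
  qq j k = q (k ∸ 1) ∘ q (k ∸ j) ∘ q (k ∸ 1)

-- LE-cactus: (t_i q_{jk})^2 = 1 in BK_P (a permutation group of L(P)),
-- i.e. as maps on L(P), for all 2 ≤ i+1 < j < k ≤ n.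
LE-cactus : ∀ {n} → FinPoset n → Set
LE-cactus {n} P =
  ∀ (i j k : ℕ) → 2 ≤ i + 1 → i + 1 < j → j < k → k ≤ n →
  ∀ (L : Vec (Fin n) n) → IsLinearExtension P L →
  let g = t P i ∘ qq P j k in g (g L) ≡ L

module _ {n : ℕ} (P : FinPoset n) where

  private
    R : Rel (Fin (suc n)) 0ℓ
    R fzero    _        = ⊤
    R (fsuc a) fzero    = ⊥
    R (fsuc a) (fsuc b) = _≼_ P a b

    R-refl : ∀ {x y} → x ≡ y → R x y
    R-refl {fzero}  refl = tt
    R-refl {fsuc a} refl = IsDecPartialOrder.refl (isDecPartialOrder P)

    R-trans : ∀ {x y z} → R x y → R y z → R x z
    R-trans {fzero}                   _ _ = tt
    R-trans {fsuc a} {fsuc b} {fsuc c} p q = IsDecPartialOrder.trans (isDecPartialOrder P) p q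

    R-antisym : ∀ {x y} → R x y → R y x → x ≡ y
    R-antisym {fzero}  {fzero}  _ _ = refl
    R-antisym {fsuc a} {fsuc b} p q = cong fsuc (IsDecPartialOrder.antisym (isDecPartialOrder P) p q)

    R? : ∀ x y → Dec (R x y)
    R? fzero    _        = yes tt
    R? (fsuc a) fzero    = no (λ ())
    R? (fsuc a) (fsuc b) = IsDecPartialOrder._≤?_ (isDecPartialOrder P) a b

    _≟F_ : ∀ {m} (x y : Fin m) → Dec (x ≡ y)
    _≟F_ = Data.Fin._≟_

  A₁⊕ : FinPoset (suc n)
  A₁⊕ = record
    { _≼_ = R
    ; isDecPartialOrder = record
      { isPartialOrder = record
        { isPreorder = record
          { isEquivalence = isEquivalence
          ; reflexive = R-refl
          ; trans = λ {x} {y} {z} → R-trans {x} {y} {z}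
          }
        ; antisym = λ {x} {y} → R-antisym {x} {y}
        }
      ; _≟_ = _≟F_
      ; _≤?_ = R?
      }
    }

-- Every linear extension of A₁ ⊕ P starts with the new minimum, so it is
-- 0 ∷ map suc v for a linear extension v of P.  On such lists t₁ acts
-- trivially and t_{i+1} acts as t_i on v; hence q_{m} acts as q_{m-1}, and
-- q_{j,k+1} as q_{jk}.  The relation (t_{i+1} q_{j,k+1})² = 1 for A₁ ⊕ P is
-- therefore (t_i q_{jk})² = 1 for P, which is the hypothesis except in the
-- boundary cases i = 0 (where t₀ = 1 and q_{jk} is an involution) and
-- j = k (where q_{jj} = q_{j-1}² = 1 and t_i is an involution).
module Submission where

open import Defs
open import Data.Nat using (ℕ; zero; suc; _+_; _∸_; _<_; _≤_; s≤s)
open import Data.Nat.Properties using (≤-refl; ≤-pred; <⇒≤; n∸n≡0; ∸-+-assoc; +-comm; m≤n⇒m<n∨m≡n; m≤n+m)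
open import Data.Fin using (Fin) renaming (zero to fzero; suc to fsuc; _<_ to _<ᶠ_)
open import Data.Fin.Properties using (suc-injective)
open import Data.Vec using (Vec; []; _∷_; lookup; map)
open import Data.Vec.Properties using (lookup-map)
open import Data.Vec.Membership.Propositional using (_∈_)
import Data.Vec.Relation.Unary.Any as Any
open import Data.Vec.Relation.Unary.Any using (there)
open import Data.Vec.Relation.Unary.Any.Properties using (lookup-index; map⁻)
open import Data.Product using (∃; _,_; swap)
open import Data.Sum using (inj₁; inj₂)
open import Data.Empty using (⊥-elim)
open import Data.Unit using (tt)
open import Relation.Nullary using (¬_; Dec; yes; no)
open import Function using (_∘_)
open import Relation.Binary.PropositionalEquality
  using (_≡_; _≢_; refl; cong; sym; trans; subst₂; module ≡-Reasoning)

open ≡-Reasoning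

module BenderKnuth {n : ℕ} (P : FinPoset n) where

  t₁-swap : ∀ {m} a b (xs : Vec (Fin n) m) → Incomparable P a b →
            t P 1 (a ∷ b ∷ xs) ≡ b ∷ a ∷ xs
  t₁-swap a b xs a∥b with incomparable? P a b
  ... | yes _   = refl
  ... | no a∦b = ⊥-elim (a∦b a∥b)

  t₁-keep : ∀ {m} a b (xs : Vec (Fin n) m) → ¬ Incomparable P a b →
            t P 1 (a ∷ b ∷ xs) ≡ a ∷ b ∷ xs
  t₁-keep a b xs a∦b with incomparable? P a b
  ... | yes a∥b = ⊥-elim (a∦b a∥b)
  ... | no _    = refl

  t-involutive : ∀ i {m} (xs : Vec (Fin n) m) → t P i (t P i xs) ≡ xs
  t-involutive zero          xs             = refl
  t-involutive (suc zero)    []             = refl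
  t-involutive (suc zero)    (a ∷ [])       = refl
  t-involutive (suc zero)    (a ∷ b ∷ xs) with incomparable? P a b
  ... | yes a∥b = t₁-swap b a xs (swap a∥b)
  ... | no a∦b  = t₁-keep a b xs a∦b
  t-involutive (suc (suc i)) []             = refl
  t-involutive (suc (suc i)) (a ∷ xs)       = cong (a ∷_) (t-involutive (suc i) xs)

  t-comm : ∀ i j {m} (xs : Vec (Fin n) m) → suc i < j → t P i (t P j xs) ≡ t P j (t P i xs)
  t-comm zero                j                   xs _ = refl
  t-comm (suc zero)          (suc (suc zero))    xs (s≤s (s≤s ()))
  t-comm (suc zero)          (suc (suc (suc j))) []           _ = refl
  t-comm (suc zero)          (suc (suc (suc j))) (a ∷ [])     _ = refl
  t-comm (suc zero)          (suc (suc (suc j))) (a ∷ b ∷ xs) _ = t₁-comm (incomparable? P a b)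
    where
      t₁-comm : Dec (Incomparable P a b) →
                t P 1 (a ∷ b ∷ t P (suc j) xs) ≡ t P (suc (suc (suc j))) (t P 1 (a ∷ b ∷ xs))
      t₁-comm (yes a∥b) rewrite t₁-swap a b xs a∥b = t₁-swap a b (t P (suc j) xs) a∥b
      t₁-comm (no a∦b)  rewrite t₁-keep a b xs a∦b = t₁-keep a b (t P (suc j) xs) a∦b
  t-comm (suc (suc i))       (suc zero)          xs (s≤s ())
  t-comm (suc (suc i))       (suc (suc j))       []       _ = refl
  t-comm (suc (suc i))       (suc (suc j))       (a ∷ xs) (s≤s i<j) =
    cong (a ∷_) (t-comm (suc i) (suc j) xs i<j)

  t-r-comm : ∀ k j xs → suc k < j → t P j (r P k xs) ≡ r P k (t P j xs)
  t-r-comm zero    j xs _   = refl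
  t-r-comm (suc k) j xs k<j = begin
    t P j (t P (suc k) (r P k xs))   ≡⟨ t-comm (suc k) j (r P k xs) k<j ⟨
    t P (suc k) (t P j (r P k xs))   ≡⟨ cong (t P (suc k)) (t-r-comm k j xs (<⇒≤ k<j)) ⟩
    t P (suc k) (r P k (t P j xs))   ∎

  t-q-comm : ∀ k j xs → suc k < j → t P j (q P k xs) ≡ q P k (t P j xs)
  t-q-comm zero    j xs _   = refl
  t-q-comm (suc k) j xs k<j = begin
    t P j (q P k (r P (suc k) xs))   ≡⟨ t-q-comm k j (r P (suc k) xs) (<⇒≤ k<j) ⟩
    q P k (t P j (r P (suc k) xs))   ≡⟨ cong (q P k) (t-r-comm (suc k) j xs k<j) ⟩
    q P k (r P (suc k) (t P j xs))   ∎

  r⁻¹ : ℕ → Vec (Fin n) n → Vec (Fin n) n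
  r⁻¹ zero    xs = xs
  r⁻¹ (suc m) xs = r⁻¹ m (t P (suc m) xs)

  r-inverseʳ : ∀ m xs → r P m (r⁻¹ m xs) ≡ xs
  r-inverseʳ zero    xs = refl
  r-inverseʳ (suc m) xs = begin
    t P (suc m) (r P m (r⁻¹ m (t P (suc m) xs)))  ≡⟨ cong (t P (suc m)) (r-inverseʳ m _) ⟩
    t P (suc m) (t P (suc m) xs)                  ≡⟨ t-involutive (suc m) xs ⟩
    xs                                            ∎

  -- q_{m+1} = q_m r_{m+1} = r_{m+1}⁻¹ q_m, since t_{m+1} commutes with q_{m-1}.
  q-suc : ∀ m xs → q P (suc m) xs ≡ r⁻¹ (suc m) (q P m xs)
  q-suc zero    xs = refl
  q-suc (suc m) xs = begin
    q P (suc m) (r P (suc (suc m)) xs)                       ≡⟨ q-suc m _ ⟩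
    r⁻¹ (suc m) (q P m (t P (suc (suc m)) (r P (suc m) xs)))  ≡⟨ cong (r⁻¹ (suc m)) (t-q-comm m (suc (suc m)) _ ≤-refl) ⟨
    r⁻¹ (suc m) (t P (suc (suc m)) (q P (suc m) xs))         ∎

  q-involutive : ∀ m xs → q P m (q P m xs) ≡ xs
  q-involutive zero    xs = refl
  q-involutive (suc m) xs = begin
    q P m (r P (suc m) (q P (suc m) xs))              ≡⟨ cong (q P m ∘ r P (suc m)) (q-suc m xs) ⟩
    q P m (r P (suc m) (r⁻¹ (suc m) (q P m xs)))      ≡⟨ cong (q P m) (r-inverseʳ (suc m) _) ⟩
    q P m (q P m xs)                                  ≡⟨ q-involutive m xs ⟩
    xs                                                ∎

  qq-involutive : ∀ j k xs → qq P j k (qq P j k xs) ≡ xs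
  qq-involutive j k xs = begin
    q P a (q P b (q P a (q P a (q P b (q P a xs)))))  ≡⟨ cong (q P a ∘ q P b) (q-involutive a _) ⟩
    q P a (q P b (q P b (q P a xs)))                  ≡⟨ cong (q P a) (q-involutive b _) ⟩
    q P a (q P a xs)                                  ≡⟨ q-involutive a xs ⟩
    xs                                                ∎
    where
      a b : ℕ
      a = k ∸ 1
      b = k ∸ j

  qq-diagonal : ∀ j xs → qq P j j xs ≡ xs
  qq-diagonal j xs rewrite n∸n≡0 j = q-involutive (j ∸ 1) xs

  -- The hypothesis is only needed away from the boundary cases i = 0 and j = k.
  cactus-relation-extended : LE-cactus P →
    ∀ i j k → i + 1 < j → j ≤ k → k ≤ n → ∀ v → IsLinearExtension P v →
    let g = t P i ∘ qq P j k in g (g v) ≡ v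
  cactus-relation-extended cactus zero j k _ _ _ v _ = qq-involutive j k v
  cactus-relation-extended cactus (suc i) j k i+1<j j≤k k≤n v isLE with m≤n⇒m<n∨m≡n j≤k
  ... | inj₁ j<k  = cactus (suc i) j k (s≤s (m≤n+m 1 i)) i+1<j j<k k≤n v isLE
  ... | inj₂ refl = begin
    t P (suc i) (qq P j j (t P (suc i) (qq P j j v)))  ≡⟨ cong (t P (suc i)) (qq-diagonal j _) ⟩
    t P (suc i) (t P (suc i) (qq P j j v))             ≡⟨ t-involutive (suc i) _ ⟩
    qq P j j v                                         ≡⟨ qq-diagonal j v ⟩
    v                                                  ∎

open BenderKnuth using (t₁-keep; t₁-swap; cactus-relation-extended)

avoiding-zero⇒map-suc : ∀ {n m} (xs : Vec (Fin (suc n)) m) → (∀ a → lookup xs a ≢ fzero) →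
                        ∃ λ v → xs ≡ map fsuc v
avoiding-zero⇒map-suc []             _      = [] , refl
avoiding-zero⇒map-suc (fzero  ∷ xs) avoids = ⊥-elim (avoids fzero refl)
avoiding-zero⇒map-suc (fsuc x ∷ xs) avoids with avoiding-zero⇒map-suc xs (avoids ∘ fsuc)
... | v , refl = x ∷ v , refl

module OrdinalSum {n : ℕ} (P : FinPoset n) where

  P⁺ : FinPoset (suc n)
  P⁺ = A₁⊕ P

  lift : Vec (Fin n) n → Vec (Fin (suc n)) (suc n)
  lift v = fzero ∷ map fsuc v

  t-map-suc : ∀ i {m} (xs : Vec (Fin n) m) → t P⁺ i (map fsuc xs) ≡ map fsuc (t P i xs)
  t-map-suc zero          xs           = refl
  t-map-suc (suc zero)    []           = refl
  t-map-suc (suc zero)    (a ∷ [])     = refl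
  t-map-suc (suc zero)    (a ∷ b ∷ xs) with incomparable? P a b
  ... | yes a∥b = t₁-swap P⁺ (fsuc a) (fsuc b) (map fsuc xs) a∥b
  ... | no a∦b  = t₁-keep P⁺ (fsuc a) (fsuc b) (map fsuc xs) a∦b
  t-map-suc (suc (suc i)) []           = refl
  t-map-suc (suc (suc i)) (a ∷ xs)     = cong (fsuc a ∷_) (t-map-suc (suc i) xs)

  t₁-lift : ∀ v → t P⁺ 1 (lift v) ≡ lift v
  t₁-lift []      = refl
  t₁-lift (a ∷ v) = t₁-keep P⁺ fzero (fsuc a) (map fsuc v) (λ { (0≰a , _) → 0≰a tt })

  t-lift : ∀ i v → t P⁺ (suc i) (lift v) ≡ lift (t P i v)
  t-lift zero    v = t₁-lift v
  t-lift (suc i) v = cong (fzero ∷_) (t-map-suc (suc i) v)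

  r-lift : ∀ m v → r P⁺ (suc m) (lift v) ≡ lift (r P m v)
  r-lift zero    v = t₁-lift v
  r-lift (suc m) v = trans (cong (t P⁺ (suc (suc m))) (r-lift m v)) (t-lift (suc m) (r P m v))

  q-lift : ∀ m v → q P⁺ m (lift v) ≡ lift (q P (m ∸ 1) v)
  q-lift zero          v = refl
  q-lift (suc zero)    v = t₁-lift v
  q-lift (suc (suc m)) v =
    trans (cong (q P⁺ (suc m)) (r-lift (suc m) v)) (q-lift (suc m) (r P (suc m) v))

  qq-lift : ∀ j k v → qq P⁺ j (suc k) (lift v) ≡ lift (qq P j k v)
  qq-lift j k v = begin
    q P⁺ k (q P⁺ (suc k ∸ j) (q P⁺ k (lift v)))          ≡⟨ cong (q P⁺ k ∘ q P⁺ (suc k ∸ j)) (q-lift k v) ⟩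
    q P⁺ k (q P⁺ (suc k ∸ j) (lift (q P a v)))           ≡⟨ cong (q P⁺ k) (q-lift (suc k ∸ j) _) ⟩
    q P⁺ k (lift (q P (suc k ∸ j ∸ 1) (q P a v)))        ≡⟨ q-lift k _ ⟩
    lift (q P a (q P (suc k ∸ j ∸ 1) (q P a v)))         ≡⟨ cong (λ b → lift (q P a (q P b (q P a v)))) suc-k∸j∸1 ⟩
    lift (q P a (q P (k ∸ j) (q P a v)))                 ∎
    where
      a : ℕ
      a = k ∸ 1
      suc-k∸j∸1 : suc k ∸ j ∸ 1 ≡ k ∸ j
      suc-k∸j∸1 = trans (∸-+-assoc (suc k) j 1) (cong (suc k ∸_) (+-comm j 1))

  cactus-move-lift : ∀ i j k v →
    let g⁺ = t P⁺ (suc i) ∘ qq P⁺ j (suc k) ; g = t P i ∘ qq P j k in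
    g⁺ (g⁺ (lift v)) ≡ lift (g (g v))
  cactus-move-lift i j k v = begin
    g⁺ (g⁺ (lift v))   ≡⟨ cong g⁺ (g⁺-lift v) ⟩
    g⁺ (lift (g v))    ≡⟨ g⁺-lift (g v) ⟩
    lift (g (g v))     ∎
    where
      g⁺ : Vec (Fin (suc n)) (suc n) → Vec (Fin (suc n)) (suc n)
      g⁺ = t P⁺ (suc i) ∘ qq P⁺ j (suc k)
      g : Vec (Fin n) n → Vec (Fin n) n
      g = t P i ∘ qq P j k
      g⁺-lift : ∀ w → g⁺ (lift w) ≡ lift (g w)
      g⁺-lift w = trans (cong (t P⁺ (suc i)) (qq-lift j k w)) (t-lift i (qq P j k w))

  linearExtension-lift : ∀ L → IsLinearExtension P⁺ L → ∃ λ v → L ≡ lift v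
  -- The minimum 0 lies below the head, so monotonicity would put its position before 0.
  linearExtension-lift (fsuc x ∷ xs) (covers , _ , monotone)
    with monotone (Any.index (covers fzero)) fzero
           (subst₂ (_≺_ P⁺) (lookup-index (covers fzero)) refl (tt , λ ()))
  ... | ()
  linearExtension-lift (fzero ∷ xs) (_ , injective , _)
    with avoiding-zero⇒map-suc xs (λ a xs[a]≡0 → 1+a≢0 (injective (fsuc a) fzero xs[a]≡0))
    where
      1+a≢0 : ∀ {a} → fsuc {n} a ≢ fzero
      1+a≢0 ()
  ... | v , refl = v , refl

  isLinearExtension-unlift : ∀ v → IsLinearExtension P⁺ (lift v) → IsLinearExtension P v
  isLinearExtension-unlift v (covers , injective , monotone) = covers′ , injective′ , monotone′
    where
      covers′ : ∀ x → x ∈ v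
      covers′ x with covers (fsuc x)
      ... | there x∈v = Any.map suc-injective (map⁻ x∈v)
      injective′ : ∀ a b → lookup v a ≡ lookup v b → a ≡ b
      injective′ a b v[a]≡v[b] = suc-injective (injective (fsuc a) (fsuc b) (begin
        lookup (map fsuc v) a   ≡⟨ lookup-map a fsuc v ⟩
        fsuc (lookup v a)       ≡⟨ cong fsuc v[a]≡v[b] ⟩
        fsuc (lookup v b)       ≡⟨ lookup-map b fsuc v ⟨
        lookup (map fsuc v) b   ∎))
      monotone′ : ∀ a b → _≺_ P (lookup v a) (lookup v b) → a <ᶠ b
      monotone′ a b (v[a]≼v[b] , v[a]≢v[b]) = ≤-pred (monotone (fsuc a) (fsuc b)
        (subst₂ (_≺_ P⁺) (sym (lookup-map a fsuc v)) (sym (lookup-map b fsuc v))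
          (v[a]≼v[b] , v[a]≢v[b] ∘ suc-injective)))

open OrdinalSum using (lift; cactus-move-lift; linearExtension-lift; isLinearExtension-unlift)

proposition3p18 : ∀ {n : ℕ} (P : FinPoset n) → LE-cactus P → LE-cactus (A₁⊕ P)
proposition3p18 P cactus zero    j k       (s≤s ()) _ _ _ _ _
proposition3p18 P cactus (suc i) j zero    _ _ () _ _ _
proposition3p18 {n} P cactus (suc i) j (suc k) _ i+2<j j<k+1 k+1≤n L isLE
  with linearExtension-lift P L isLE
... | v , refl = begin
  g⁺ (g⁺ (lift P v))   ≡⟨ cactus-move-lift P i j k v ⟩
  lift P (g (g v))     ≡⟨ cong (lift P) (cactus-relation-extended P cactus i j k
                            (<⇒≤ i+2<j) (≤-pred j<k+1) (≤-pred k+1≤n) v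
                            (isLinearExtension-unlift P v isLE)) ⟩
  lift P v             ∎
  where
    g⁺ : Vec (Fin (suc n)) (suc n) → Vec (Fin (suc n)) (suc n)
    g⁺ = t (A₁⊕ P) (suc i) ∘ qq (A₁⊕ P) j (suc k)
    g : Vec (Fin n) n → Vec (Fin n) n
    g = t P i ∘ qq P j k
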